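{- Let $\ell>3$ be a prime, $d,m\geq1$ integers, and let $W(\mathbb{F}_{\ell^d})$ be the ring of Witt vectors of $\mathbb{F}_{\ell^d}$. Let $B_m\subset\mathrm{GL}_2(W(\mathbb{F}_{\ell^d})/\ell^m W(\mathbb{F}_{\ell^d}))$ be a subgroup whose reduction mod $\ell$ is $\mathrm{GL}_2(\mathbb{F}_\ell)\subset\mathrm{GL}_2(\mathbb{F}_{\ell^d})$. Then there is an element of the form $I+\ell X\in\mathrm{GL}_2(W(\mathbb{F}_{\ell^d})/\ell^m W(\mathbb{F}_{\ell^d}))$ such that the conjugate of $B_m$ by $I+\ell X$ contains a matrix $\begin{pmatrix} a&0\\0&1\end{pmatrix}$ with $a\in(\mathbb{Z}/\ell^m\mathbb{Z})^*$ and $a\not\equiv\pm1 \pmod{\ell}$. -}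

module Defs where

open import Data.Nat using (ℕ; zero; suc)
open import Data.Integer using (ℤ; +_; _+_; _*_; -_; _-_)
open import Data.List using (List; []; _∷_; map)
open import Data.Product using (Σ; ∃; ∃₂; _×_)
open import Relation.Binary.PropositionalEquality using (_≡_)

-- Integer polynomials as coefficient lists (lowest degree first).

Poly : Set
Poly = List ℤ

coeff : Poly → ℕ → ℤ
coeff []      _       = + 0
coeff (c ∷ p) zero    = c
coeff (c ∷ p) (suc i) = coeff p i

infixl 6 _⊕_ _⊖_
infixl 7 _⊛_

_⊕_ : Poly → Poly → Poly
[]      ⊕ q       = q
(a ∷ p) ⊕ []      = a ∷ p
(a ∷ p) ⊕ (b ∷ q) = (a + b) ∷ (p ⊕ q)

neg : Poly → Poly
neg = map (λ x → - x)

_⊖_ : Poly → Poly → Poly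
p ⊖ q = p ⊕ neg q

scale : ℤ → Poly → Poly
scale c = map (c *_)

_⊛_ : Poly → Poly → Poly
[]      ⊛ q = []
(a ∷ p) ⊛ q = scale a q ⊕ (+ 0 ∷ (p ⊛ q))

const : ℤ → Poly
const c = c ∷ []

-- equality of polynomials (coefficientwise, ignoring trailing zeros)
_≐_ : Poly → Poly → Set
p ≐ q = ∀ i → coeff p i ≡ coeff q i

-- The quotient ring ℤ[x]/(N, f), as a setoid on Poly.
-- For N = ℓ^m and f monic of degree d irreducible mod ℓ this is
-- W(F_{ℓ^d}) / ℓ^m W(F_{ℓ^d});  for N = ℓ it is F_{ℓ^d}.

Cong : ℤ → Poly → Poly → Poly → Set
Cong N f p q = ∃₂ λ g h → (p ⊖ q) ≐ (scale N g ⊕ (f ⊛ h))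

IsUnitMod : ℤ → Poly → Poly → Set
IsUnitMod N f p = ∃ λ u → Cong N f (p ⊛ u) (const (+ 1))

IsFieldQuot : ℤ → Poly → Set
IsFieldQuot ℓ f = ∀ p → (Cong ℓ f p (const (+ 0)) → Data.Empty.⊥) → IsUnitMod ℓ f p
  where import Data.Empty

MonicOfDegree : ℕ → Poly → Set
MonicOfDegree d f = (coeff f d ≡ + 1) × (∀ i → coeff f (suc (i Data.Nat.+ d)) ≡ + 0)
  where import Data.Nat

record Mat2 : Set where
  constructor mat
  field
    m11 m12 m21 m22 : Poly
open Mat2 public

_⊗_ : Mat2 → Mat2 → Mat2
A ⊗ B = mat (m11 A ⊛ m11 B ⊕ m12 A ⊛ m21 B) (m11 A ⊛ m12 B ⊕ m12 A ⊛ m22 B)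
            (m21 A ⊛ m11 B ⊕ m22 A ⊛ m21 B) (m21 A ⊛ m12 B ⊕ m22 A ⊛ m22 B)

_⊞_ : Mat2 → Mat2 → Mat2
A ⊞ B = mat (m11 A ⊕ m11 B) (m12 A ⊕ m12 B) (m21 A ⊕ m21 B) (m22 A ⊕ m22 B)

mscale : ℤ → Mat2 → Mat2
mscale c A = mat (scale c (m11 A)) (scale c (m12 A)) (scale c (m21 A)) (scale c (m22 A))

det : Mat2 → Poly
det A = m11 A ⊛ m22 A ⊖ m12 A ⊛ m21 A

I₂ : Mat2
I₂ = mat (const (+ 1)) (const (+ 0)) (const (+ 0)) (const (+ 1))

intMat : ℤ → ℤ → ℤ → ℤ → Mat2
intMat a b c e = mat (const a) (const b) (const c) (const e)

MCong : ℤ → Poly → Mat2 → Mat2 → Set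
MCong N f A B = Cong N f (m11 A) (m11 B) × Cong N f (m12 A) (m12 B)
              × Cong N f (m21 A) (m21 B) × Cong N f (m22 A) (m22 B)

InGL2 : ℤ → Poly → Mat2 → Set
InGL2 N f A = IsUnitMod N f (det A)

-- B is a subgroup of GL₂(ℤ[x]/(N, f)) (as a predicate on representatives,
-- closed under the congruence)
record IsSubgroupGL2 (N : ℤ) (f : Poly) (B : Mat2 → Set) : Set where
  field
    respects : ∀ {A A'} → MCong N f A A' → B A → B A'
    inGL     : ∀ {A} → B A → InGL2 N f A
    hasId    : B I₂
    closed   : ∀ {A A'} → B A → B A' → B (A ⊗ A')
    inverses : ∀ {A} → B A → ∃ λ A' → B A' × MCong N f (A ⊗ A') I₂

module Submission where

-- Lift A ∈ B_m with A ≡ diag(2, 1) (mod ℓ).  As the eigenvalues 2 and 1 are distinct mod ℓ,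
-- Hensel's lemma solves the two quadratics that make the columns of P = [[1, u], [v, 1]],
-- u ≡ v ≡ 0 (mod ℓ), eigenvectors of A modulo ℓᵐ: P⁻¹ A P ≡ diag(λ, μ) with λ ≡ 2 and μ ≡ 1
-- (mod ℓ).  Since x ≡ y (mod ℓᵏ) implies x^ℓ ≡ y^ℓ (mod ℓᵏ⁺¹), the power n = ℓᵐ⁻¹ gives
-- λⁿ ≡ 2ⁿ and μⁿ ≡ 1 (mod ℓᵐ), so P⁻¹ Aⁿ P ≡ diag(a, 1) with a = 2ⁿ.  By Fermat a ≡ 2 (mod ℓ),
-- hence a ≢ 0, ±1 as ℓ > 3.

open import Defs
open import Level using (0ℓ)
open import Data.Nat as ℕ using (ℕ; zero; suc)
import Data.Nat.Properties as ℕ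
import Data.Nat.Divisibility as ℕ
open import Data.Integer using (ℤ; +_)
import Data.Integer.Properties as ℤ
open import Data.List using ([]; _∷_)
open import Data.Product using (_,_; _×_; ∃; ∃₂)
open import Relation.Binary.PropositionalEquality as ≡ using (_≡_; cong₂)
open import Relation.Binary.Structures using (IsEquivalence)
open import Relation.Binary.Bundles using (Setoid)
import Relation.Binary.Reasoning.Setoid
open import Function using (_∘_)
open import Relation.Binary.Core using (Rel)
open import Relation.Nullary using (yes)
open import Data.Maybe as Maybe using (Maybe; just; nothing)
open import Algebra.Structures using (IsCommutativeRing)
import Tactic.RingSolver as Solver
open import Tactic.RingSolver.Core.AlmostCommutativeRing using (AlmostCommutativeRing; fromCommutativeRing)
open import Algebra.Bundles using (CommutativeRing; CommutativeSemiring; Monoid)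

-- The ring ℤ[X]

infix 4 _≈ₚ_
record _≈ₚ_ (p q : Poly) : Set where
  constructor coeffwise
  field coeff-≡ : p ≐ q
open _≈ₚ_

shift : Poly → Poly
shift p = + 0 ∷ p

0ₚ 1ₚ : Poly
0ₚ = const (+ 0)
1ₚ = const (+ 1)

module ℤ[X]-Properties where

  open import Data.Integer using (_+_; _*_; -_)
  open import Data.Integer.Tactic.RingSolver using (solve-∀)

  coeff-⊕ : ∀ p q i → coeff (p ⊕ q) i ≡ coeff p i + coeff q i
  coeff-⊕ []      q       i       = ≡.sym (ℤ.+-identityˡ _)
  coeff-⊕ (a ∷ p) []      i       = ≡.sym (ℤ.+-identityʳ _)
  coeff-⊕ (a ∷ p) (b ∷ q) zero    = ≡.refl
  coeff-⊕ (a ∷ p) (b ∷ q) (suc i) = coeff-⊕ p q i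

  coeff-neg : ∀ p i → coeff (neg p) i ≡ - coeff p i
  coeff-neg []      i       = ≡.refl
  coeff-neg (a ∷ p) zero    = ≡.refl
  coeff-neg (a ∷ p) (suc i) = coeff-neg p i

  coeff-scale : ∀ c p i → coeff (scale c p) i ≡ c * coeff p i
  coeff-scale c []      i       = ≡.sym (ℤ.*-zeroʳ c)
  coeff-scale c (a ∷ p) zero    = ≡.refl
  coeff-scale c (a ∷ p) (suc i) = coeff-scale c p i

  ≈ₚ-refl : ∀ {p} → p ≈ₚ p
  ≈ₚ-refl = coeffwise λ _ → ≡.refl

  ≈ₚ-sym : ∀ {p q} → p ≈ₚ q → q ≈ₚ p
  ≈ₚ-sym (coeffwise e) = coeffwise λ i → ≡.sym (e i)

  ≈ₚ-trans : ∀ {p q r} → p ≈ₚ q → q ≈ₚ r → p ≈ₚ r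
  ≈ₚ-trans (coeffwise e) (coeffwise e′) = coeffwise λ i → ≡.trans (e i) (e′ i)

  ≈ₚ-isEquivalence : IsEquivalence _≈ₚ_
  ≈ₚ-isEquivalence = record { refl = ≈ₚ-refl ; sym = ≈ₚ-sym ; trans = ≈ₚ-trans }

  ≈ₚ-setoid : Setoid 0ℓ 0ℓ
  ≈ₚ-setoid = record { isEquivalence = ≈ₚ-isEquivalence }

  module ≈ₚ-Reasoning = Relation.Binary.Reasoning.Setoid ≈ₚ-setoid

  ∷-cong : ∀ {a b p q} → a ≡ b → p ≈ₚ q → a ∷ p ≈ₚ b ∷ q
  ∷-cong a≡b (coeffwise e) = coeffwise λ { zero → a≡b ; (suc i) → e i }

  shift-cong : ∀ {p q} → p ≈ₚ q → shift p ≈ₚ shift q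
  shift-cong = ∷-cong ≡.refl

  ⊕-cong : ∀ {p p′ q q′} → p ≈ₚ p′ → q ≈ₚ q′ → p ⊕ q ≈ₚ p′ ⊕ q′
  ⊕-cong {p} {p′} {q} {q′} (coeffwise e) (coeffwise e′) = coeffwise λ i →
    ≡.trans (coeff-⊕ p q i) (≡.trans (cong₂ _+_ (e i) (e′ i)) (≡.sym (coeff-⊕ p′ q′ i)))

  neg-cong : ∀ {p q} → p ≈ₚ q → neg p ≈ₚ neg q
  neg-cong {p} {q} (coeffwise e) = coeffwise λ i →
    ≡.trans (coeff-neg p i) (≡.trans (≡.cong -_ (e i)) (≡.sym (coeff-neg q i)))

  scale-cong : ∀ c {p q} → p ≈ₚ q → scale c p ≈ₚ scale c q
  scale-cong c {p} {q} (coeffwise e) = coeffwise λ i →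
    ≡.trans (coeff-scale c p i) (≡.trans (≡.cong (c *_) (e i)) (≡.sym (coeff-scale c q i)))

  ⊕-comm : ∀ p q → p ⊕ q ≈ₚ q ⊕ p
  ⊕-comm p q = coeffwise λ i → begin
    coeff (p ⊕ q) i        ≡⟨ coeff-⊕ p q i ⟩
    coeff p i + coeff q i  ≡⟨ ℤ.+-comm (coeff p i) _ ⟩
    coeff q i + coeff p i  ≡⟨ coeff-⊕ q p i ⟨
    coeff (q ⊕ p) i        ∎
    where open ≡.≡-Reasoning

  ⊕-assoc : ∀ p q r → (p ⊕ q) ⊕ r ≈ₚ p ⊕ (q ⊕ r)
  ⊕-assoc p q r = coeffwise λ i → begin
    coeff ((p ⊕ q) ⊕ r) i
      ≡⟨ ≡.trans (coeff-⊕ (p ⊕ q) r i) (cong₂ _+_ (coeff-⊕ p q i) ≡.refl) ⟩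
    (coeff p i + coeff q i) + coeff r i
      ≡⟨ ℤ.+-assoc (coeff p i) _ _ ⟩
    coeff p i + (coeff q i + coeff r i)
      ≡⟨ ≡.trans (coeff-⊕ p (q ⊕ r) i) (cong₂ _+_ (≡.refl {x = coeff p i}) (coeff-⊕ q r i)) ⟨
    coeff (p ⊕ (q ⊕ r)) i ∎
    where open ≡.≡-Reasoning

  ⊕-identityʳ : ∀ p → p ⊕ [] ≈ₚ p
  ⊕-identityʳ p = coeffwise λ i → ≡.trans (coeff-⊕ p [] i) (ℤ.+-identityʳ _)

  ⊕-inverseˡ : ∀ p → neg p ⊕ p ≈ₚ []
  ⊕-inverseˡ p = coeffwise λ i → ≡.trans (coeff-⊕ (neg p) p i)
    (≡.trans (cong₂ _+_ (coeff-neg p i) ≡.refl) (ℤ.+-inverseˡ (coeff p i)))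

  ⊕-inverseʳ : ∀ p → p ⊕ neg p ≈ₚ []
  ⊕-inverseʳ p = ≈ₚ-trans (⊕-comm p (neg p)) (⊕-inverseˡ p)

  scale-⊕ : ∀ c p q → scale c (p ⊕ q) ≈ₚ scale c p ⊕ scale c q
  scale-⊕ c p q = coeffwise λ i → begin
    coeff (scale c (p ⊕ q)) i
      ≡⟨ ≡.trans (coeff-scale c (p ⊕ q) i) (≡.cong (c *_) (coeff-⊕ p q i)) ⟩
    c * (coeff p i + coeff q i)
      ≡⟨ ℤ.*-distribˡ-+ c (coeff p i) _ ⟩
    c * coeff p i + c * coeff q i
      ≡⟨ ≡.trans (coeff-⊕ (scale c p) (scale c q) i) (cong₂ _+_ (coeff-scale c p i) (coeff-scale c q i)) ⟨
    coeff (scale c p ⊕ scale c q) i ∎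
    where open ≡.≡-Reasoning

  scale-+ : ∀ a b p → scale (a + b) p ≈ₚ scale a p ⊕ scale b p
  scale-+ a b p = coeffwise λ i → begin
    coeff (scale (a + b) p) i
      ≡⟨ coeff-scale (a + b) p i ⟩
    (a + b) * coeff p i
      ≡⟨ ℤ.*-distribʳ-+ (coeff p i) a b ⟩
    a * coeff p i + b * coeff p i
      ≡⟨ ≡.trans (coeff-⊕ (scale a p) (scale b p) i) (cong₂ _+_ (coeff-scale a p i) (coeff-scale b p i)) ⟨
    coeff (scale a p ⊕ scale b p) i ∎
    where open ≡.≡-Reasoning

  scale-scale : ∀ a b p → scale a (scale b p) ≈ₚ scale (a * b) p
  scale-scale a b p = coeffwise λ i → begin
    coeff (scale a (scale b p)) i
      ≡⟨ ≡.trans (coeff-scale a (scale b p) i) (≡.cong (a *_) (coeff-scale b p i)) ⟩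
    a * (b * coeff p i) ≡⟨ ℤ.*-assoc a b _ ⟨
    a * b * coeff p i   ≡⟨ coeff-scale (a * b) p i ⟨
    coeff (scale (a * b) p) i ∎
    where open ≡.≡-Reasoning

  scale-zero : ∀ p → scale (+ 0) p ≈ₚ []
  scale-zero p = coeffwise (coeff-scale (+ 0) p)

  scale-identity : ∀ p → scale (+ 1) p ≈ₚ p
  scale-identity p = coeffwise λ i → ≡.trans (coeff-scale (+ 1) p i) (ℤ.*-identityˡ _)

  scale-shift : ∀ c p → scale c (shift p) ≈ₚ shift (scale c p)
  scale-shift c p = ∷-cong (ℤ.*-zeroʳ c) ≈ₚ-refl

  shift-[] : shift [] ≈ₚ []
  shift-[] = coeffwise λ { zero → ≡.refl ; (suc i) → ≡.refl }

  ⊕-interchange : ∀ p q r s → (p ⊕ q) ⊕ (r ⊕ s) ≈ₚ (p ⊕ r) ⊕ (q ⊕ s)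
  ⊕-interchange p q r s = coeffwise λ i → begin
    coeff ((p ⊕ q) ⊕ (r ⊕ s)) i
      ≡⟨ ≡.trans (coeff-⊕ (p ⊕ q) (r ⊕ s) i) (cong₂ _+_ (coeff-⊕ p q i) (coeff-⊕ r s i)) ⟩
    (coeff p i + coeff q i) + (coeff r i + coeff s i)
      ≡⟨ ℤ-interchange (coeff p i) _ _ _ ⟩
    (coeff p i + coeff r i) + (coeff q i + coeff s i)
      ≡⟨ ≡.trans (coeff-⊕ (p ⊕ r) (q ⊕ s) i) (cong₂ _+_ (coeff-⊕ p r i) (coeff-⊕ q s i)) ⟨
    coeff ((p ⊕ r) ⊕ (q ⊕ s)) i ∎
    where
    open ≡.≡-Reasoning
    ℤ-interchange : ∀ a b c d → (a + b) + (c + d) ≡ (a + c) + (b + d)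
    ℤ-interchange = solve-∀

  ⊛-zeroʳ : ∀ p → p ⊛ [] ≈ₚ []
  ⊛-zeroʳ []      = ≈ₚ-refl
  ⊛-zeroʳ (a ∷ p) = ≈ₚ-trans (shift-cong (⊛-zeroʳ p)) shift-[]

  ⊛-zeroˡ : ∀ {p} q → p ≈ₚ [] → p ⊛ q ≈ₚ []
  ⊛-zeroˡ {[]}    q _             = ≈ₚ-refl
  ⊛-zeroˡ {a ∷ p} q (coeffwise e) with e zero
  ... | ≡.refl = ≈ₚ-trans (⊕-cong (scale-zero q) (shift-cong (⊛-zeroˡ {p} q (coeffwise (e ∘ suc))))) shift-[]

  ⊛-congˡ : ∀ {p p′} q → p ≈ₚ p′ → p ⊛ q ≈ₚ p′ ⊛ q
  ⊛-congˡ {[]}    {p′}     q e             = ≈ₚ-sym (⊛-zeroˡ q (≈ₚ-sym e))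
  ⊛-congˡ {a ∷ p} {[]}     q e             = ⊛-zeroˡ q e
  ⊛-congˡ {a ∷ p} {b ∷ p′} q (coeffwise e) with e zero
  ... | ≡.refl = ⊕-cong ≈ₚ-refl (shift-cong (⊛-congˡ {p} {p′} q (coeffwise (e ∘ suc))))

  ⊛-congʳ : ∀ p {q q′} → q ≈ₚ q′ → p ⊛ q ≈ₚ p ⊛ q′
  ⊛-congʳ []      e = ≈ₚ-refl
  ⊛-congʳ (a ∷ p) e = ⊕-cong (scale-cong a e) (shift-cong (⊛-congʳ p e))

  ⊛-shiftˡ : ∀ p q → shift p ⊛ q ≈ₚ shift (p ⊛ q)
  ⊛-shiftˡ p q = ⊕-cong (scale-zero q) ≈ₚ-refl

  ⊛-shiftʳ : ∀ p q → p ⊛ shift q ≈ₚ shift (p ⊛ q)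
  ⊛-shiftʳ []      q = ≈ₚ-sym shift-[]
  ⊛-shiftʳ (a ∷ p) q = ⊕-cong (scale-shift a q) (shift-cong (⊛-shiftʳ p q))

  ⊛-distribˡ : ∀ p q r → p ⊛ (q ⊕ r) ≈ₚ p ⊛ q ⊕ p ⊛ r
  ⊛-distribˡ []      q r = ≈ₚ-refl
  ⊛-distribˡ (a ∷ p) q r = ≈ₚ-trans
    (⊕-cong (scale-⊕ a q r) (shift-cong (⊛-distribˡ p q r)))
    (⊕-interchange (scale a q) (scale a r) (shift (p ⊛ q)) (shift (p ⊛ r)))

  ⊛-distribʳ : ∀ r p q → (p ⊕ q) ⊛ r ≈ₚ p ⊛ r ⊕ q ⊛ r
  ⊛-distribʳ r []      q       = ≈ₚ-refl
  ⊛-distribʳ r (a ∷ p) []      = ≈ₚ-sym (⊕-identityʳ _)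
  ⊛-distribʳ r (a ∷ p) (b ∷ q) = ≈ₚ-trans
    (⊕-cong (scale-+ a b r) (shift-cong (⊛-distribʳ r p q)))
    (⊕-interchange (scale a r) (scale b r) (shift (p ⊛ r)) (shift (q ⊛ r)))

  ⊛-const : ∀ p b → p ⊛ const b ≈ₚ scale b p
  ⊛-const []      b = ≈ₚ-refl
  ⊛-const (a ∷ p) b = ∷-cong (≡.trans (ℤ.+-identityʳ _) (ℤ.*-comm a b)) (⊛-const p b)

  const-⊛ : ∀ b p → const b ⊛ p ≈ₚ scale b p
  const-⊛ b p = ≈ₚ-trans (⊕-cong ≈ₚ-refl shift-[]) (⊕-identityʳ (scale b p))

  ⊛-comm : ∀ p q → p ⊛ q ≈ₚ q ⊛ p
  ⊛-comm []      q = ≈ₚ-sym (⊛-zeroʳ q)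
  ⊛-comm (a ∷ p) q = begin
    scale a q ⊕ shift (p ⊛ q)       ≈⟨ ⊕-cong (≈ₚ-sym (⊛-const q a)) (shift-cong (⊛-comm p q)) ⟩
    q ⊛ const a ⊕ shift (q ⊛ p)     ≈⟨ ⊕-cong ≈ₚ-refl (≈ₚ-sym (⊛-shiftʳ q p)) ⟩
    q ⊛ const a ⊕ q ⊛ shift p       ≈⟨ ⊛-distribˡ q (const a) (shift p) ⟨
    q ⊛ (const a ⊕ shift p)         ≈⟨ ⊛-congʳ q (∷-cong (ℤ.+-identityʳ a) ≈ₚ-refl) ⟩
    q ⊛ (a ∷ p)                     ∎
    where open ≈ₚ-Reasoning

  scale-⊛ : ∀ c p q → scale c p ⊛ q ≈ₚ scale c (p ⊛ q)
  scale-⊛ c []      q = ≈ₚ-refl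
  scale-⊛ c (a ∷ p) q = begin
    scale (c * a) q ⊕ shift (scale c p ⊛ q)        ≈⟨ ⊕-cong (≈ₚ-sym (scale-scale c a q)) (shift-cong (scale-⊛ c p q)) ⟩
    scale c (scale a q) ⊕ shift (scale c (p ⊛ q))  ≈⟨ ⊕-cong ≈ₚ-refl (≈ₚ-sym (scale-shift c (p ⊛ q))) ⟩
    scale c (scale a q) ⊕ scale c (shift (p ⊛ q))  ≈⟨ scale-⊕ c (scale a q) (shift (p ⊛ q)) ⟨
    scale c (scale a q ⊕ shift (p ⊛ q))            ∎
    where open ≈ₚ-Reasoning

  ⊛-assoc : ∀ p q r → (p ⊛ q) ⊛ r ≈ₚ p ⊛ (q ⊛ r)
  ⊛-assoc []      q r = ≈ₚ-refl
  ⊛-assoc (a ∷ p) q r = begin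
    (scale a q ⊕ shift (p ⊛ q)) ⊛ r          ≈⟨ ⊛-distribʳ r (scale a q) (shift (p ⊛ q)) ⟩
    scale a q ⊛ r ⊕ shift (p ⊛ q) ⊛ r        ≈⟨ ⊕-cong (scale-⊛ a q r) (⊛-shiftˡ (p ⊛ q) r) ⟩
    scale a (q ⊛ r) ⊕ shift ((p ⊛ q) ⊛ r)    ≈⟨ ⊕-cong ≈ₚ-refl (shift-cong (⊛-assoc p q r)) ⟩
    scale a (q ⊛ r) ⊕ shift (p ⊛ (q ⊛ r))    ∎
    where open ≈ₚ-Reasoning

  ⊛-identityˡ : ∀ p → 1ₚ ⊛ p ≈ₚ p
  ⊛-identityˡ p = ≈ₚ-trans (const-⊛ (+ 1) p) (scale-identity p)

  ⊛-identityʳ : ∀ p → p ⊛ 1ₚ ≈ₚ p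
  ⊛-identityʳ p = ≈ₚ-trans (⊛-comm p _) (⊛-identityˡ p)

  const-⊛-const : ∀ a b → const (+ a) ⊛ const (+ b) ≈ₚ const (+ (a ℕ.* b))
  const-⊛-const a b = ∷-cong (≡.trans (ℤ.+-identityʳ _) (≡.sym (ℤ.pos-* a b))) ≈ₚ-refl

  isZero : ∀ p → Maybe ([] ≈ₚ p)
  isZero []      = just ≈ₚ-refl
  isZero (a ∷ p) with a ℤ.≟ + 0 | isZero p
  ... | yes ≡.refl | just (coeffwise e) = just (coeffwise λ { zero → ≡.refl ; (suc i) → e i })
  ... | _          | _                  = nothing

  isCommutativeRing : IsCommutativeRing _≈ₚ_ _⊕_ _⊛_ neg [] 1ₚ
  isCommutativeRing = record
    { isRing = record
      { +-isAbelianGroup = record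
        { isGroup = record
          { isMonoid = record
            { isSemigroup = record
              { isMagma = record { isEquivalence = ≈ₚ-isEquivalence ; ∙-cong = ⊕-cong }
              ; assoc = ⊕-assoc }
            ; identity = (λ _ → ≈ₚ-refl) , ⊕-identityʳ }
          ; inverse = ⊕-inverseˡ , ⊕-inverseʳ
          ; ⁻¹-cong = neg-cong }
        ; comm = ⊕-comm }
      ; *-cong = λ {p} {p′} {q} e e′ → ≈ₚ-trans (⊛-congˡ q e) (⊛-congʳ p′ e′)
      ; *-assoc = ⊛-assoc
      ; *-identity = ⊛-identityˡ , ⊛-identityʳ
      ; distrib = ⊛-distribˡ , ⊛-distribʳ }
    ; *-comm = ⊛-comm }

-- Quotients of ℤ[X]

-- The rings ℤ[X]/(f), ℤ[X]/(N, f), … are all represented on the carrier Poly with the operations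
-- of Defs, so that Mat2 and its product serve for each of them.
record Quotient : Set₁ where
  infix 4 _≈_
  field
    _≈_               : Rel Poly 0ℓ
    isCommutativeRing : IsCommutativeRing _≈_ _⊕_ _⊛_ neg [] 1ₚ
    ≈ₚ⇒≈              : ∀ {p q} → p ≈ₚ q → p ≈ q

  commutativeRing : CommutativeRing 0ℓ 0ℓ
  commutativeRing = record { isCommutativeRing = isCommutativeRing }

ℤ[X] : Quotient
ℤ[X] = record
  { _≈_ = _≈ₚ_ ; isCommutativeRing = ℤ[X]-Properties.isCommutativeRing ; ≈ₚ⇒≈ = λ e → e }

-- The zero test lets the ring solver discard vanishing constant coefficients.
almostCommutativeRing : Quotient → AlmostCommutativeRing 0ℓ 0ℓ
almostCommutativeRing R = fromCommutativeRing commutativeRing (Maybe.map ≈ₚ⇒≈ ∘ ℤ[X]-Properties.isZero)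
  where open Quotient R

module QuotientProperties (R : Quotient) where

  open Quotient R public
  open CommutativeRing commutativeRing public
    using (setoid; refl; sym; trans; +-cong; +-congˡ; +-congʳ; *-cong; *-congˡ; *-congʳ; -‿cong; *-comm; +-comm;
           zeroʳ; *-identityˡ; *-identityʳ; semiring; commutativeSemiring; *-commutativeSemigroup)
  open import Algebra.Definitions.RawSemiring (CommutativeSemiring.rawSemiring commutativeSemiring) public
    using (_^_)
  open import Algebra.Properties.CommutativeSemigroup.Divisibility *-commutativeSemigroup public
    using (_∣_; _,_; ∣ʳ-respʳ-≈; ∣ʳ-respˡ-≈; ∣ʳ-trans; ∙-cong-∣; x∣ʳy⇒x∣ʳzy; x∣xy)
  module ≈-Reasoning = Relation.Binary.Reasoning.Setoid setoid

  private
    ring : AlmostCommutativeRing 0ℓ 0ℓ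
    ring = almostCommutativeRing R

  0ₚ≈[] : 0ₚ ≈ []
  0ₚ≈[] = ≈ₚ⇒≈ ℤ[X]-Properties.shift-[]

  ∣-⊕ : ∀ {g x y} → g ∣ x → g ∣ y → g ∣ x ⊕ y
  ∣-⊕ {g} (q , qg≈x) (r , rg≈y) = q ⊕ r , trans (distribʳ g q r) (+-cong qg≈x rg≈y)
    where
    distribʳ : ∀ g q r → (q ⊕ r) ⊛ g ≈ q ⊛ g ⊕ r ⊛ g
    distribʳ = Solver.solve-∀ ring

  ∣-neg : ∀ {g x} → g ∣ x → g ∣ neg x
  ∣-neg {g} (q , qg≈x) = neg q , trans (neg-distribˡ q g) (-‿cong qg≈x)
    where
    neg-distribˡ : ∀ q g → neg q ⊛ g ≈ neg (q ⊛ g)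
    neg-distribˡ = Solver.solve-∀ ring

  ∣-⊛ʳ : ∀ {g x} y → g ∣ x → g ∣ x ⊛ y
  ∣-⊛ʳ {x = x} y g∣x = ∣ʳ-respʳ-≈ (*-comm y x) (x∣ʳy⇒x∣ʳzy y g∣x)

  ∣-^ : ∀ {g x} n → g ∣ x → g ^ n ∣ x ^ n
  ∣-^ zero    g∣x = 1ₚ , *-identityˡ 1ₚ
  ∣-^ (suc n) g∣x = ∙-cong-∣ g∣x (∣-^ n g∣x)

  infix 4 _≈_mod_
  record _≈_mod_ (x y g : Poly) : Set where
    constructor ≈mod
    field divides : g ∣ x ⊖ y
  open _≈_mod_ public

  module _ {g : Poly} where

    ≈⇒≈-mod : ∀ {x y} → x ≈ y → x ≈ y mod g
    ≈⇒≈-mod {x} {y} x≈y = ≈mod ([] , sym (trans (+-congʳ x≈y) (⊖-self y)))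
      where
      ⊖-self : ∀ y → y ⊖ y ≈ []
      ⊖-self = Solver.solve-∀ ring

    ≈-mod-refl : ∀ x → x ≈ x mod g
    ≈-mod-refl x = ≈⇒≈-mod (refl {x = x})

    ≈-mod-sym : ∀ {x y} → x ≈ y mod g → y ≈ x mod g
    ≈-mod-sym {x} {y} (≈mod g∣x-y) = ≈mod (∣ʳ-respʳ-≈ (identity x y) (∣-neg g∣x-y))
      where
      identity : ∀ x y → neg (x ⊖ y) ≈ y ⊖ x
      identity = Solver.solve-∀ ring

    ≈-mod-trans : ∀ {x y z} → x ≈ y mod g → y ≈ z mod g → x ≈ z mod g
    ≈-mod-trans {x} {y} {z} (≈mod g∣x-y) (≈mod g∣y-z) = ≈mod (∣ʳ-respʳ-≈ (identity x y z) (∣-⊕ g∣x-y g∣y-z))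
      where
      identity : ∀ x y z → (x ⊖ y) ⊕ (y ⊖ z) ≈ x ⊖ z
      identity = Solver.solve-∀ ring

    ⊕-cong-mod : ∀ {x y u v} → x ≈ y mod g → u ≈ v mod g → x ⊕ u ≈ y ⊕ v mod g
    ⊕-cong-mod {x} {y} {u} {v} (≈mod g∣x-y) (≈mod g∣u-v) =
      ≈mod (∣ʳ-respʳ-≈ (identity x y u v) (∣-⊕ g∣x-y g∣u-v))
      where
      identity : ∀ x y u v → (x ⊖ y) ⊕ (u ⊖ v) ≈ (x ⊕ u) ⊖ (y ⊕ v)
      identity = Solver.solve-∀ ring

    ⊛-cong-mod : ∀ {x y u v} → x ≈ y mod g → u ≈ v mod g → x ⊛ u ≈ y ⊛ v mod g
    ⊛-cong-mod {x} {y} {u} {v} (≈mod g∣x-y) (≈mod g∣u-v) =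
      ≈mod (∣ʳ-respʳ-≈ (identity x y u v) (∣-⊕ (∣-⊛ʳ u g∣x-y) (x∣ʳy⇒x∣ʳzy y g∣u-v)))
      where
      identity : ∀ x y u v → (x ⊖ y) ⊛ u ⊕ y ⊛ (u ⊖ v) ≈ x ⊛ u ⊖ y ⊛ v
      identity = Solver.solve-∀ ring

    neg-cong-mod : ∀ {x y} → x ≈ y mod g → neg x ≈ neg y mod g
    neg-cong-mod {x} {y} (≈mod g∣x-y) = ≈mod (∣ʳ-respʳ-≈ (identity x y) (∣-neg g∣x-y))
      where
      identity : ∀ x y → neg (x ⊖ y) ≈ neg x ⊖ neg y
      identity = Solver.solve-∀ ring

  -- Abstract: otherwise comparing two quotient rings unfolds these proofs, which is very costly.
  abstract
    quotient-isCommutativeRing : ∀ g → IsCommutativeRing (λ x y → x ≈ y mod g) _⊕_ _⊛_ neg [] 1ₚ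
    quotient-isCommutativeRing g = record
      { isRing = record
        { +-isAbelianGroup = record
          { isGroup = record
            { isMonoid = record
              { isSemigroup = record
                { isMagma = record
                  { isEquivalence = record
                    { refl = ≈-mod-refl _ ; sym = ≈-mod-sym ; trans = ≈-mod-trans }
                  ; ∙-cong = ⊕-cong-mod }
                ; assoc = λ x y z → ≈⇒≈-mod (CR.+-assoc x y z) }
              ; identity = ≈⇒≈-mod ∘ CR.+-identityˡ , ≈⇒≈-mod ∘ CR.+-identityʳ }
            ; inverse = ≈⇒≈-mod ∘ CR.-‿inverseˡ , ≈⇒≈-mod ∘ CR.-‿inverseʳ
            ; ⁻¹-cong = neg-cong-mod }
          ; comm = λ x y → ≈⇒≈-mod (CR.+-comm x y) }
        ; *-cong = ⊛-cong-mod
        ; *-assoc = λ x y z → ≈⇒≈-mod (CR.*-assoc x y z)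
        ; *-identity = ≈⇒≈-mod ∘ CR.*-identityˡ , ≈⇒≈-mod ∘ CR.*-identityʳ
        ; distrib = (λ x y z → ≈⇒≈-mod (CR.distribˡ x y z)) , (λ x y z → ≈⇒≈-mod (CR.distribʳ x y z)) }
      ; *-comm = λ x y → ≈⇒≈-mod (CR.*-comm x y) }
      where module CR = CommutativeRing commutativeRing

  quotient : Poly → Quotient
  quotient g = record
    { _≈_ = λ x y → x ≈ y mod g
    ; isCommutativeRing = quotient-isCommutativeRing g
    ; ≈ₚ⇒≈ = ≈⇒≈-mod ∘ ≈ₚ⇒≈ }

  module _ (g : Poly) where
    open import Algebra.Definitions.RawSemiring
      (CommutativeSemiring.rawSemiring (CommutativeRing.commutativeSemiring (Quotient.commutativeRing (quotient g))))
      using () renaming (_^_ to _^′_)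

    -- R / g has its own power function, which agrees with that of R only up to ≈.
    quotient-^ : ∀ x n → x ^′ n ≈ x ^ n mod g
    quotient-^ x zero    = ≈-mod-refl 1ₚ
    quotient-^ x (suc n) = ⊛-cong-mod (≈-mod-refl x) (quotient-^ x n)

  ∣-resp-mod : ∀ {g x y} → x ≈ y mod g → g ∣ y → g ∣ x
  ∣-resp-mod {x = x} {y} (≈mod g∣x-y) g∣y = ∣ʳ-respʳ-≈ (identity x y) (∣-⊕ g∣x-y g∣y)
    where
    identity : ∀ x y → (x ⊖ y) ⊕ y ≈ x
    identity = Solver.solve-∀ ring

  ∣⇒≈0ₚ-mod : ∀ {g x} → g ∣ x → x ≈ 0ₚ mod g
  ∣⇒≈0ₚ-mod {x = x} g∣x = ≈mod (∣ʳ-respʳ-≈ (identity x) g∣x)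
    where
    identity : ∀ x → x ≈ x ⊖ 0ₚ
    identity = Solver.solve-∀ ring

  ≈0ₚ-mod⇒∣ : ∀ {g x} → x ≈ 0ₚ mod g → g ∣ x
  ≈0ₚ-mod⇒∣ x≈0 = ∣-resp-mod x≈0 ([] , sym 0ₚ≈[])

  ⊕-vanishingʳ-mod : ∀ {g x y z} → g ∣ z → x ≈ y mod g → x ⊕ z ≈ y mod g
  ⊕-vanishingʳ-mod {x = x} {y} {z} g∣z (≈mod g∣x-y) = ≈mod (∣ʳ-respʳ-≈ (identity x y z) (∣-⊕ g∣x-y g∣z))
    where
    identity : ∀ x y z → (x ⊖ y) ⊕ z ≈ (x ⊕ z) ⊖ y
    identity = Solver.solve-∀ ring

infixl 7 _/_
_/_ : Quotient → Poly → Quotient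
R / g = QuotientProperties.quotient R g

-- Geometric sums and Hensel lifting

module Lifting (R : Quotient) where

  open QuotientProperties R
  open import Algebra.Properties.Semiring.Exp semiring using (^-congʳ; ^-assocʳ)

  private
    ring : AlmostCommutativeRing 0ℓ 0ℓ
    ring = almostCommutativeRing R

  const-^ : ∀ a n → const (+ a) ^ n ≈ const (+ (a ℕ.^ n))
  const-^ a zero    = refl
  const-^ a (suc n) = trans (*-congˡ {x = const (+ a)} (const-^ a n)) (≈ₚ⇒≈ (ℤ[X]-Properties.const-⊛-const a (a ℕ.^ n)))

  ^-assocˡ : ∀ x m n → x ^ (m ℕ.* n) ≈ (x ^ n) ^ m
  ^-assocˡ x m n = trans (^-congʳ x (ℕ.*-comm m n)) (sym (^-assocʳ x n m))

  geometricSum : Poly → Poly → ℕ → Poly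
  geometricSum x y zero    = []
  geometricSum x y (suc n) = x ^ n ⊕ y ⊛ geometricSum x y n

  difference-of-powers : ∀ x y n → x ^ n ⊖ y ^ n ≈ (x ⊖ y) ⊛ geometricSum x y n
  difference-of-powers x y zero    = trans 0ₚ≈[] (sym (zeroʳ (x ⊖ y)))
  difference-of-powers x y (suc n) = begin
    x ⊛ x ^ n ⊖ y ⊛ y ^ n                                  ≈⟨ split x y (x ^ n) (y ^ n) ⟩
    (x ⊖ y) ⊛ x ^ n ⊕ y ⊛ (x ^ n ⊖ y ^ n)                  ≈⟨ +-congˡ {x = (x ⊖ y) ⊛ x ^ n} (*-congˡ {x = y} (difference-of-powers x y n)) ⟩
    (x ⊖ y) ⊛ x ^ n ⊕ y ⊛ ((x ⊖ y) ⊛ geometricSum x y n)  ≈⟨ collect x y (x ^ n) (geometricSum x y n) ⟩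
    (x ⊖ y) ⊛ (x ^ n ⊕ y ⊛ geometricSum x y n)            ∎
    where
    open ≈-Reasoning
    split : ∀ x y X Y → x ⊛ X ⊖ y ⊛ Y ≈ (x ⊖ y) ⊛ X ⊕ y ⊛ (X ⊖ Y)
    split = Solver.solve-∀ ring
    collect : ∀ x y X S → (x ⊖ y) ⊛ X ⊕ y ⊛ ((x ⊖ y) ⊛ S) ≈ (x ⊖ y) ⊛ (X ⊕ y ⊛ S)
    collect = Solver.solve-∀ ring

  ^-cong-mod : ∀ {g x y} n → x ≈ y mod g → x ^ n ≈ y ^ n mod g
  ^-cong-mod {x = x} {y} n (≈mod g∣x-y) =
    ≈mod (∣ʳ-respʳ-≈ (sym (difference-of-powers x y n)) (∣-⊛ʳ (geometricSum x y n) g∣x-y))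

  geometricSum-cong-mod : ∀ {g x y} n → x ≈ y mod g → geometricSum x y n ≈ geometricSum y y n mod g
  geometricSum-cong-mod             zero    x≈y = ≈-mod-refl []
  geometricSum-cong-mod {y = y} (suc n) x≈y =
    ⊕-cong-mod (^-cong-mod n x≈y) (⊛-cong-mod (≈-mod-refl y) (geometricSum-cong-mod n x≈y))

  geometricSum-diagonal : ∀ y n → geometricSum y y (suc n) ≈ const (+ suc n) ⊛ y ^ n
  geometricSum-diagonal y zero    = base y (y ^ 0)
    where
    base : ∀ y Y → Y ⊕ y ⊛ [] ≈ 1ₚ ⊛ Y
    base = Solver.solve-∀ ring
  geometricSum-diagonal y (suc n) = begin
    y ⊛ y ^ n ⊕ y ⊛ geometricSum y y (suc n)       ≈⟨ +-congˡ {x = y ⊛ y ^ n} (*-congˡ {x = y} (geometricSum-diagonal y n)) ⟩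
    y ⊛ y ^ n ⊕ y ⊛ (const (+ suc n) ⊛ y ^ n)     ≈⟨ collect y (y ^ n) (const (+ suc n)) ⟩
    (1ₚ ⊕ const (+ suc n)) ⊛ (y ⊛ y ^ n)          ∎
    where
    open ≈-Reasoning
    collect : ∀ y Y c → y ⊛ Y ⊕ y ⊛ (c ⊛ Y) ≈ (1ₚ ⊕ c) ⊛ (y ⊛ Y)
    collect = Solver.solve-∀ ring

  geometricSum-vanishes : ∀ {g x y} n → g ∣ const (+ n) → x ≈ y mod g → g ∣ geometricSum x y n
  geometricSum-vanishes zero    _     _   = [] , refl
  geometricSum-vanishes {y = y} (suc n) g∣n x≈y = ∣-resp-mod (geometricSum-cong-mod (suc n) x≈y)
    (∣ʳ-respʳ-≈ (sym (geometricSum-diagonal y n)) (∣-⊛ʳ (y ^ n) g∣n))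

  modulus-resp : ∀ {g h x y} → g ≈ h → x ≈ y mod g → x ≈ y mod h
  modulus-resp g≈h (≈mod g∣x-y) = ≈mod (∣ʳ-respˡ-≈ g≈h g∣x-y)

  -- xᵖ − yᵖ = (x − y) · geometricSum x y p, and the second factor is ≡ p yᵖ⁻¹ ≡ 0 (mod π).
  ^-lift : ∀ {π x y} p k → π ∣ const (+ p) → x ≈ y mod π → x ≈ y mod π ^ k → x ^ p ≈ y ^ p mod π ^ suc k
  ^-lift {x = x} {y} p k π∣p x≈y (≈mod πᵏ∣x-y) =
    ≈mod (∣ʳ-respʳ-≈ factorisation (∙-cong-∣ (geometricSum-vanishes p π∣p x≈y) πᵏ∣x-y))
    where
    factorisation : geometricSum x y p ⊛ (x ⊖ y) ≈ x ^ p ⊖ y ^ p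
    factorisation = trans (*-comm (geometricSum x y p) (x ⊖ y)) (sym (difference-of-powers x y p))

  ^-lift-iterate : ∀ {π x y} p → π ∣ const (+ p) → x ≈ y mod π →
                   ∀ k → x ^ (p ℕ.^ k) ≈ y ^ (p ℕ.^ k) mod π ^ suc k
  ^-lift-iterate {π} p π∣p x≈y zero = modulus-resp (sym (*-identityʳ π)) (^-cong-mod 1 x≈y)
  ^-lift-iterate {π} {x} {y} p π∣p x≈y (suc k) = ≈-mod-trans (≈⇒≈-mod (^-assocˡ x p (p ℕ.^ k)))
    (≈-mod-trans (^-lift p (suc k) π∣p (^-cong-mod (p ℕ.^ k) x≈y) (^-lift-iterate p π∣p x≈y k))
                 (≈⇒≈-mod (sym (^-assocˡ y p (p ℕ.^ k)))))

  -- Newton's method: t is an approximate inverse of the derivative b + 2av at every approximate root v.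
  hensel : ∀ {π a b c t} → π ∣ a → π ∣ c → b ⊛ t ≈ 1ₚ mod π →
           ∀ k → ∃ λ v → π ∣ v × a ⊛ v ⊛ v ⊕ b ⊛ v ≈ c mod π ^ suc k
  hensel {π} {a} {b} {c} π∣a π∣c bt≈1 zero =
    [] , ([] , refl) , ≈mod (∣ʳ-respˡ-≈ (sym (*-identityʳ π)) (∣ʳ-respʳ-≈ (at-zero a b c) (∣-neg π∣c)))
    where
    at-zero : ∀ a b c → neg c ≈ a ⊛ [] ⊛ [] ⊕ b ⊛ [] ⊖ c
    at-zero = Solver.solve-∀ ring
  hensel {π} {a} {b} {c} {t} π∣a π∣c bt≈1 (suc k) with hensel {π} {a} {b} {c} {t} π∣a π∣c bt≈1 k
  ... | v , π∣v , ≈mod πᵏ∣δ =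
    v ⊖ t ⊛ δ , π∣v′ , ≈mod (∣ʳ-respʳ-≈ (sym (newton-step a b c v t)) (∙-cong-∣ π∣F πᵏ∣δ))
    where
    δ F : Poly
    δ = a ⊛ v ⊛ v ⊕ b ⊛ v ⊖ c
    F = (1ₚ ⊖ b ⊛ t) ⊕ a ⊛ t ⊛ (t ⊛ δ ⊖ v ⊖ v)
    newton-step : ∀ a b c v t → let δ = a ⊛ v ⊛ v ⊕ b ⊛ v ⊖ c ; w = v ⊖ t ⊛ δ in
      a ⊛ w ⊛ w ⊕ b ⊛ w ⊖ c ≈ ((1ₚ ⊖ b ⊛ t) ⊕ a ⊛ t ⊛ (t ⊛ δ ⊖ v ⊖ v)) ⊛ δ
    newton-step = Solver.solve-∀ ring
    π∣δ : π ∣ δ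
    π∣δ = ∣ʳ-trans (x∣xy π (π ^ k)) πᵏ∣δ
    π∣v′ : π ∣ v ⊖ t ⊛ δ
    π∣v′ = ∣-⊕ π∣v (∣-neg (x∣ʳy⇒x∣ʳzy t π∣δ))
    π∣F : π ∣ F
    π∣F = ∣-⊕ (divides (≈-mod-sym bt≈1)) (∣-⊛ʳ (t ⊛ δ ⊖ v ⊖ v) (∣-⊛ʳ t π∣a))

  1ₚ^n≈1ₚ : ∀ n → 1ₚ ^ n ≈ 1ₚ
  1ₚ^n≈1ₚ n = trans (const-^ 1 n) (≈ₚ⇒≈ (ℤ[X]-Properties.∷-cong (≡.cong +_ (ℕ.^-zeroˡ n)) ℤ[X]-Properties.≈ₚ-refl))

  geometricSum-inverse : ∀ {g w} n → g ∣ w → (1ₚ ⊖ w) ⊛ geometricSum 1ₚ w n ≈ 1ₚ mod g ^ n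
  geometricSum-inverse {g} {w} n g∣w = ≈mod (∣ʳ-respʳ-≈ neg-wⁿ≈ (∣-neg (∣-^ n g∣w)))
    where
    open ≈-Reasoning
    regroup : ∀ W → neg W ≈ (1ₚ ⊖ W) ⊖ 1ₚ
    regroup = Solver.solve-∀ ring
    neg-wⁿ≈ : neg (w ^ n) ≈ (1ₚ ⊖ w) ⊛ geometricSum 1ₚ w n ⊖ 1ₚ
    neg-wⁿ≈ = begin
      neg (w ^ n)                           ≈⟨ regroup (w ^ n) ⟩
      (1ₚ ⊖ w ^ n) ⊖ 1ₚ                     ≈⟨ +-congʳ {x = neg 1ₚ} (+-congʳ {x = neg (w ^ n)} (1ₚ^n≈1ₚ n)) ⟨
      (1ₚ ^ n ⊖ w ^ n) ⊖ 1ₚ                 ≈⟨ +-congʳ {x = neg 1ₚ} (difference-of-powers 1ₚ w n) ⟩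
      (1ₚ ⊖ w) ⊛ geometricSum 1ₚ w n ⊖ 1ₚ  ∎

  geometricSum-≈1 : ∀ {g w} n → g ∣ w → geometricSum 1ₚ w (suc n) ≈ 1ₚ mod g
  geometricSum-≈1 {w = w} n g∣w = ⊕-vanishingʳ-mod (∣-⊛ʳ (geometricSum 1ₚ w n) g∣w) (≈⇒≈-mod (1ₚ^n≈1ₚ n))


-- 2 × 2 matrices over a quotient of ℤ[X]

diag : Poly → Poly → Mat2
diag x y = mat x 0ₚ 0ₚ y

infixr 25 _^ᴹ_
_^ᴹ_ : Mat2 → ℕ → Mat2
A ^ᴹ zero  = I₂
A ^ᴹ suc n = A ⊗ A ^ᴹ n

eigenvectors : Poly → Poly → Mat2
eigenvectors u v = mat 1ₚ u v 1ₚ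

eigenvectors⁻¹ : Poly → Poly → Poly → Mat2
eigenvectors⁻¹ d u v = mat d (neg (d ⊛ u)) (neg (d ⊛ v)) d

module MatrixProperties (R : Quotient) where

  open QuotientProperties R

  private
    ring : AlmostCommutativeRing 0ℓ 0ℓ
    ring = almostCommutativeRing R

  infix 4 _≈ᴹ_
  record _≈ᴹ_ (A B : Mat2) : Set where
    constructor entrywise
    field
      ≈₁₁ : m11 A ≈ m11 B
      ≈₁₂ : m12 A ≈ m12 B
      ≈₂₁ : m21 A ≈ m21 B
      ≈₂₂ : m22 A ≈ m22 B

  ≈ᴹ-isEquivalence : IsEquivalence _≈ᴹ_
  ≈ᴹ-isEquivalence = record
    { refl  = entrywise refl refl refl refl
    ; sym   = λ (entrywise a b c d) → entrywise (sym a) (sym b) (sym c) (sym d)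
    ; trans = λ (entrywise a b c d) (entrywise a′ b′ c′ d′) →
                entrywise (trans a a′) (trans b b′) (trans c c′) (trans d d′) }

  ⊗-cong : ∀ {A A′ B B′} → A ≈ᴹ A′ → B ≈ᴹ B′ → A ⊗ B ≈ᴹ A′ ⊗ B′
  ⊗-cong (entrywise a b c d) (entrywise a′ b′ c′ d′) = entrywise
    (+-cong (*-cong a a′) (*-cong b c′)) (+-cong (*-cong a b′) (*-cong b d′))
    (+-cong (*-cong c a′) (*-cong d c′)) (+-cong (*-cong c b′) (*-cong d d′))

  ⊗-congˡ : ∀ A {B B′} → B ≈ᴹ B′ → A ⊗ B ≈ᴹ A ⊗ B′
  ⊗-congˡ A = ⊗-cong (IsEquivalence.refl ≈ᴹ-isEquivalence {A})

  ⊗-congʳ : ∀ {A A′} B → A ≈ᴹ A′ → A ⊗ B ≈ᴹ A′ ⊗ B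
  ⊗-congʳ B A≈A′ = ⊗-cong A≈A′ (IsEquivalence.refl ≈ᴹ-isEquivalence {B})

  ⊗-assoc : ∀ A B C → (A ⊗ B) ⊗ C ≈ᴹ A ⊗ (B ⊗ C)
  ⊗-assoc (mat a₁ a₂ a₃ a₄) (mat b₁ b₂ b₃ b₄) (mat c₁ c₂ c₃ c₄) = entrywise
    (entry a₁ a₂ b₁ b₂ b₃ b₄ c₁ c₃) (entry a₁ a₂ b₁ b₂ b₃ b₄ c₂ c₄)
    (entry a₃ a₄ b₁ b₂ b₃ b₄ c₁ c₃) (entry a₃ a₄ b₁ b₂ b₃ b₄ c₂ c₄)
    where
    entry : ∀ x₁ x₂ y₁ y₂ y₃ y₄ z₁ z₂ →
      (x₁ ⊛ y₁ ⊕ x₂ ⊛ y₃) ⊛ z₁ ⊕ (x₁ ⊛ y₂ ⊕ x₂ ⊛ y₄) ⊛ z₂ ≈ x₁ ⊛ (y₁ ⊛ z₁ ⊕ y₂ ⊛ z₂) ⊕ x₂ ⊛ (y₃ ⊛ z₁ ⊕ y₄ ⊛ z₂)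
    entry = Solver.solve-∀ ring

  ⊗-identityˡ : ∀ A → I₂ ⊗ A ≈ᴹ A
  ⊗-identityˡ (mat a b c d) = entrywise (first a c) (first b d) (second a c) (second b d)
    where
    first : ∀ x y → 1ₚ ⊛ x ⊕ 0ₚ ⊛ y ≈ x
    first = Solver.solve-∀ ring
    second : ∀ x y → 0ₚ ⊛ x ⊕ 1ₚ ⊛ y ≈ y
    second = Solver.solve-∀ ring

  ⊗-identityʳ : ∀ A → A ⊗ I₂ ≈ᴹ A
  ⊗-identityʳ (mat a b c d) = entrywise (first a b) (second a b) (first c d) (second c d)
    where
    first : ∀ x y → x ⊛ 1ₚ ⊕ y ⊛ 0ₚ ≈ x
    first = Solver.solve-∀ ring
    second : ∀ x y → x ⊛ 0ₚ ⊕ y ⊛ 1ₚ ≈ y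
    second = Solver.solve-∀ ring

  ⊗-monoid : Monoid 0ℓ 0ℓ
  ⊗-monoid = record
    { Carrier = Mat2 ; _≈_ = _≈ᴹ_ ; _∙_ = _⊗_ ; ε = I₂
    ; isMonoid = record
      { isSemigroup = record
        { isMagma = record { isEquivalence = ≈ᴹ-isEquivalence ; ∙-cong = ⊗-cong }
        ; assoc = ⊗-assoc }
      ; identity = ⊗-identityˡ , ⊗-identityʳ } }

  open Monoid ⊗-monoid public using () renaming (refl to ≈ᴹ-refl; sym to ≈ᴹ-sym; trans to ≈ᴹ-trans)
  module ≈ᴹ-Reasoning = Relation.Binary.Reasoning.Setoid (Monoid.setoid ⊗-monoid)

  ^ᴹ-semiconj : ∀ {A P D} → A ⊗ P ≈ᴹ P ⊗ D → ∀ n → A ^ᴹ n ⊗ P ≈ᴹ P ⊗ D ^ᴹ n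
  ^ᴹ-semiconj {A} {P} {D} AP≈PD zero    = ≈ᴹ-trans (⊗-identityˡ P) (≈ᴹ-sym (⊗-identityʳ P))
  ^ᴹ-semiconj {A} {P} {D} AP≈PD (suc n) = begin
    (A ⊗ A ^ᴹ n) ⊗ P    ≈⟨ ⊗-assoc A (A ^ᴹ n) P ⟩
    A ⊗ (A ^ᴹ n ⊗ P)    ≈⟨ ⊗-congˡ A (^ᴹ-semiconj AP≈PD n) ⟩
    A ⊗ (P ⊗ D ^ᴹ n)    ≈⟨ ⊗-assoc A P (D ^ᴹ n) ⟨
    (A ⊗ P) ⊗ D ^ᴹ n    ≈⟨ ⊗-congʳ (D ^ᴹ n) AP≈PD ⟩
    (P ⊗ D) ⊗ D ^ᴹ n    ≈⟨ ⊗-assoc P D (D ^ᴹ n) ⟩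
    P ⊗ (D ⊗ D ^ᴹ n)    ∎
    where open ≈ᴹ-Reasoning

  conjugate-^ᴹ : ∀ {A P Q D} → A ⊗ P ≈ᴹ P ⊗ D → Q ⊗ P ≈ᴹ I₂ → ∀ n → (Q ⊗ A ^ᴹ n) ⊗ P ≈ᴹ D ^ᴹ n
  conjugate-^ᴹ {A} {P} {Q} {D} AP≈PD QP≈I n = begin
    (Q ⊗ A ^ᴹ n) ⊗ P    ≈⟨ ⊗-assoc Q (A ^ᴹ n) P ⟩
    Q ⊗ (A ^ᴹ n ⊗ P)    ≈⟨ ⊗-congˡ Q (^ᴹ-semiconj AP≈PD n) ⟩
    Q ⊗ (P ⊗ D ^ᴹ n)    ≈⟨ ⊗-assoc Q P (D ^ᴹ n) ⟨
    (Q ⊗ P) ⊗ D ^ᴹ n    ≈⟨ ⊗-congʳ (D ^ᴹ n) QP≈I ⟩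
    I₂ ⊗ D ^ᴹ n         ≈⟨ ⊗-identityˡ (D ^ᴹ n) ⟩
    D ^ᴹ n              ∎
    where open ≈ᴹ-Reasoning

  diag-⊗-diag : ∀ x y x′ y′ → diag x y ⊗ diag x′ y′ ≈ᴹ diag (x ⊛ x′) (y ⊛ y′)
  diag-⊗-diag x y x′ y′ =
    entrywise (first x x′) (trans (off x y′) (sym 0ₚ≈[])) (trans (off′ x′ y) (sym 0ₚ≈[])) (second y y′)
    where
    first : ∀ x x′ → x ⊛ x′ ⊕ 0ₚ ⊛ 0ₚ ≈ x ⊛ x′
    first = Solver.solve-∀ ring
    off : ∀ x y′ → x ⊛ 0ₚ ⊕ 0ₚ ⊛ y′ ≈ []
    off = Solver.solve-∀ ring
    off′ : ∀ x′ y → 0ₚ ⊛ x′ ⊕ y ⊛ 0ₚ ≈ []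
    off′ = Solver.solve-∀ ring
    second : ∀ y y′ → 0ₚ ⊛ 0ₚ ⊕ y ⊛ y′ ≈ y ⊛ y′
    second = Solver.solve-∀ ring

  diag-^ᴹ : ∀ x y n → diag x y ^ᴹ n ≈ᴹ diag (x ^ n) (y ^ n)
  diag-^ᴹ x y zero    = ≈ᴹ-refl {I₂}
  diag-^ᴹ x y (suc n) = ≈ᴹ-trans (⊗-congˡ (diag x y) (diag-^ᴹ x y n)) (diag-⊗-diag x y (x ^ n) (y ^ n))

  eigenvectors-diagonalise : ∀ p q r s u v →
    r ⊛ u ⊛ u ⊕ (s ⊖ p) ⊛ u ≈ q → q ⊛ v ⊛ v ⊕ (p ⊖ s) ⊛ v ≈ r →
    mat p q r s ⊗ eigenvectors u v ≈ᴹ eigenvectors u v ⊗ diag (p ⊕ q ⊛ v) (r ⊛ u ⊕ s)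
  eigenvectors-diagonalise p q r s u v u-root v-root = entrywise
    (diagonal₁₁ p q u v)
    (trans (+-congˡ {x = p ⊛ u} (*-congʳ {x = 1ₚ} (sym u-root))) (corner₁₂ p r s u))
    (trans (+-congʳ {x = s ⊛ v} (*-congʳ {x = 1ₚ} (sym v-root))) (corner₂₁ p q s v))
    (diagonal₂₂ r s u v)
    where
    diagonal₁₁ : ∀ p q u v → p ⊛ 1ₚ ⊕ q ⊛ v ≈ 1ₚ ⊛ (p ⊕ q ⊛ v) ⊕ u ⊛ 0ₚ
    diagonal₁₁ = Solver.solve-∀ ring
    corner₁₂ : ∀ p r s u → p ⊛ u ⊕ (r ⊛ u ⊛ u ⊕ (s ⊖ p) ⊛ u) ⊛ 1ₚ ≈ 1ₚ ⊛ 0ₚ ⊕ u ⊛ (r ⊛ u ⊕ s)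
    corner₁₂ = Solver.solve-∀ ring
    corner₂₁ : ∀ p q s v → (q ⊛ v ⊛ v ⊕ (p ⊖ s) ⊛ v) ⊛ 1ₚ ⊕ s ⊛ v ≈ v ⊛ (p ⊕ q ⊛ v) ⊕ 1ₚ ⊛ 0ₚ
    corner₂₁ = Solver.solve-∀ ring
    diagonal₂₂ : ∀ r s u v → r ⊛ u ⊕ s ⊛ 1ₚ ≈ v ⊛ 0ₚ ⊕ 1ₚ ⊛ (r ⊛ u ⊕ s)
    diagonal₂₂ = Solver.solve-∀ ring

  eigenvectors⁻¹-inverse : ∀ d u v → (1ₚ ⊖ u ⊛ v) ⊛ d ≈ 1ₚ → eigenvectors⁻¹ d u v ⊗ eigenvectors u v ≈ᴹ I₂
  eigenvectors⁻¹-inverse d u v det⁻¹ = entrywise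
    (trans (diagonal₁₁ d u v) det⁻¹) (trans (corner₁₂ d u) (sym 0ₚ≈[]))
    (trans (corner₂₁ d v) (sym 0ₚ≈[])) (trans (diagonal₂₂ d u v) det⁻¹)
    where
    diagonal₁₁ : ∀ d u v → d ⊛ 1ₚ ⊕ neg (d ⊛ u) ⊛ v ≈ (1ₚ ⊖ u ⊛ v) ⊛ d
    diagonal₁₁ = Solver.solve-∀ ring
    corner₁₂ : ∀ d u → d ⊛ u ⊕ neg (d ⊛ u) ⊛ 1ₚ ≈ []
    corner₁₂ = Solver.solve-∀ ring
    corner₂₁ : ∀ d v → neg (d ⊛ v) ⊛ 1ₚ ⊕ d ⊛ v ≈ []
    corner₂₁ = Solver.solve-∀ ring
    diagonal₂₂ : ∀ d u v → neg (d ⊛ v) ⊛ u ⊕ d ⊛ 1ₚ ≈ (1ₚ ⊖ u ⊛ v) ⊛ d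
    diagonal₂₂ = Solver.solve-∀ ring

-- Diagonalisation modulo powers of π

module Conjugation (R : Quotient) where

  open QuotientProperties R
  open Lifting R
  open module M {g} = MatrixProperties (R / g) using (entrywise)

  private
    ring : AlmostCommutativeRing 0ℓ 0ℓ
    ring = almostCommutativeRing R

  infix 4 _≈ᴹ_mod_
  _≈ᴹ_mod_ : Mat2 → Mat2 → Poly → Set
  A ≈ᴹ B mod g = MatrixProperties._≈ᴹ_ (R / g) A B

  ≈ᴹ-modulus-resp : ∀ {g h A B} → g ≈ h → A ≈ᴹ B mod g → A ≈ᴹ B mod h
  ≈ᴹ-modulus-resp g≈h (entrywise e₁₁ e₁₂ e₂₁ e₂₂) =
    entrywise (modulus-resp g≈h e₁₁) (modulus-resp g≈h e₁₂) (modulus-resp g≈h e₂₁) (modulus-resp g≈h e₂₂)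

  eigenvectors≈I₂ : ∀ {π u v} → π ∣ u → π ∣ v → eigenvectors u v ≈ᴹ I₂ mod π
  eigenvectors≈I₂ π∣u π∣v = entrywise (≈-mod-refl 1ₚ) (∣⇒≈0ₚ-mod π∣u) (∣⇒≈0ₚ-mod π∣v) (≈-mod-refl 1ₚ)

  eigenvectors-invertible : ∀ {π u v} → π ∣ u → π ∣ v → ∀ m →
    ∃ λ d → eigenvectors⁻¹ d u v ≈ᴹ I₂ mod π × eigenvectors⁻¹ d u v ⊗ eigenvectors u v ≈ᴹ I₂ mod π ^ suc m
  eigenvectors-invertible {π} {u} {v} π∣u π∣v m =
    d , entrywise d≈1 (small (x∣ʳy⇒x∣ʳzy d π∣u)) (small (x∣ʳy⇒x∣ʳzy d π∣v)) d≈1 ,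
    MatrixProperties.eigenvectors⁻¹-inverse (R / π ^ suc m) d u v (geometricSum-inverse (suc m) π∣uv)
    where
    π∣uv : π ∣ u ⊛ v
    π∣uv = ∣-⊛ʳ v π∣u
    d : Poly
    d = geometricSum 1ₚ (u ⊛ v) (suc m)
    d≈1 : d ≈ 1ₚ mod π
    d≈1 = geometricSum-≈1 m π∣uv
    small : ∀ {x} → π ∣ x → neg x ≈ 0ₚ mod π
    small = ∣⇒≈0ₚ-mod ∘ ∣-neg

  eigenvectors-exist : ∀ {π A α β t} → A ≈ᴹ diag α β mod π → (β ⊖ α) ⊛ t ≈ 1ₚ mod π → ∀ m →
    ∃₂ λ u v → π ∣ u × π ∣ v × ∃₂ λ e₁ e₂ → e₁ ≈ α mod π × e₂ ≈ β mod π ×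
      A ⊗ eigenvectors u v ≈ᴹ eigenvectors u v ⊗ diag e₁ e₂ mod π ^ suc m
  eigenvectors-exist {π} {mat a₁₁ a₁₂ a₂₁ a₂₂} {α} {β} {t} (entrywise a₁₁≈α a₁₂≈0 a₂₁≈0 a₂₂≈β) gap m =
    let u , π∣u , u-root = hensel {π} {a₂₁} {a₂₂ ⊖ a₁₁} {a₁₂} {t} π∣a₂₁ π∣a₁₂ slope m
        v , π∣v , v-root = hensel {π} {a₁₂} {a₁₁ ⊖ a₂₂} {a₂₁} {neg t} π∣a₁₂ π∣a₂₁ slope′ m
    in
    u , v , π∣u , π∣v , a₁₁ ⊕ a₁₂ ⊛ v , a₂₁ ⊛ u ⊕ a₂₂ ,
    ⊕-vanishingʳ-mod (∣-⊛ʳ v π∣a₁₂) a₁₁≈α ,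
    ≈-mod-trans (≈⇒≈-mod (+-comm (a₂₁ ⊛ u) a₂₂)) (⊕-vanishingʳ-mod (∣-⊛ʳ u π∣a₂₁) a₂₂≈β) ,
    MatrixProperties.eigenvectors-diagonalise (R / π ^ suc m) a₁₁ a₁₂ a₂₁ a₂₂ u v u-root v-root
    where
    π∣a₁₂ : π ∣ a₁₂
    π∣a₁₂ = ≈0ₚ-mod⇒∣ a₁₂≈0
    π∣a₂₁ : π ∣ a₂₁
    π∣a₂₁ = ≈0ₚ-mod⇒∣ a₂₁≈0
    slope : (a₂₂ ⊖ a₁₁) ⊛ t ≈ 1ₚ mod π
    slope = ≈-mod-trans (⊛-cong-mod (⊕-cong-mod a₂₂≈β (neg-cong-mod a₁₁≈α)) (≈-mod-refl t)) gap
    swap : ∀ x y t → (x ⊖ y) ⊛ neg t ≈ (y ⊖ x) ⊛ t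
    swap = Solver.solve-∀ ring
    slope′ : (a₁₁ ⊖ a₂₂) ⊛ neg t ≈ 1ₚ mod π
    slope′ = ≈-mod-trans (≈⇒≈-mod (swap a₁₁ a₂₂ t)) slope

  conjugate-power-to-diagonal : ∀ {π A α β t} p m → π ∣ const (+ p) →
    A ≈ᴹ diag α β mod π → (β ⊖ α) ⊛ t ≈ 1ₚ mod π →
    ∃₂ λ Q P → Q ≈ᴹ I₂ mod π × P ≈ᴹ I₂ mod π × Q ⊗ P ≈ᴹ I₂ mod π ^ suc m ×
               (Q ⊗ A ^ᴹ (p ℕ.^ m)) ⊗ P ≈ᴹ diag (α ^ (p ℕ.^ m)) (β ^ (p ℕ.^ m)) mod π ^ suc m
  conjugate-power-to-diagonal {π} {A} {α} {β} p m π∣p A≈diag gap =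
    let u , v , π∣u , π∣v , e₁ , e₂ , e₁≈α , e₂≈β , AP≈PD = eigenvectors-exist {π} A≈diag gap m
        d , Q≈I , QP≈I = eigenvectors-invertible {π} π∣u π∣v m
    in eigenvectors⁻¹ d u v , eigenvectors u v , Q≈I , eigenvectors≈I₂ π∣u π∣v , QP≈I ,
       ≈ᴹ-trans (conjugate-^ᴹ {A} {eigenvectors u v} {eigenvectors⁻¹ d u v} {diag e₁ e₂} AP≈PD QP≈I N)
                (≈ᴹ-trans (diag-^ᴹ e₁ e₂ N)
                          (entrywise (eigenvalue-power e₁≈α) (≈-mod-refl 0ₚ) (≈-mod-refl 0ₚ) (eigenvalue-power e₂≈β)))
    where
    open MatrixProperties (R / π ^ suc m) using (≈ᴹ-trans; conjugate-^ᴹ; diag-^ᴹ)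
    open QuotientProperties (R / π ^ suc m) using () renaming (_^_ to _^ₛ_)
    N : ℕ
    N = p ℕ.^ m
    eigenvalue-power : ∀ {x y} → x ≈ y mod π → x ^ₛ N ≈ y ^ N mod π ^ suc m
    eigenvalue-power {x} x≈y = ≈-mod-trans (quotient-^ (π ^ suc m) x N) (^-lift-iterate p π∣p x≈y m)

-- The rings ℤ[X]/(N, f)

module CongProperties (f : Poly) where

  open QuotientProperties (ℤ[X] / f)
  open Lifting (ℤ[X] / f) using (const-^; 1ₚ^n≈1ₚ)
  module ℤX = QuotientProperties ℤ[X]

  private
    ring ring/f : AlmostCommutativeRing 0ℓ 0ℓ
    ring = almostCommutativeRing ℤ[X]
    ring/f = almostCommutativeRing (ℤ[X] / f)

  Cong⇒≈mod : ∀ {N x y} → Cong N f x y → x ≈ y mod const N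
  Cong⇒≈mod {N} {x} {y} (g , h , x-y≐) = ≈mod (g , ℤX.≈mod (neg h ℤX., multiple))
    where
    open ℤX.≈-Reasoning
    rearrange : ∀ G f h → neg h ⊛ f ≈ₚ G ⊖ (G ⊕ f ⊛ h)
    rearrange = Solver.solve-∀ ring
    multiple : neg h ⊛ f ≈ₚ g ⊛ const N ⊖ (x ⊖ y)
    multiple = begin
      neg h ⊛ f                             ≈⟨ rearrange (g ⊛ const N) f h ⟩
      g ⊛ const N ⊖ (g ⊛ const N ⊕ f ⊛ h)  ≈⟨ ℤX.+-congˡ {x = g ⊛ const N}
                                                 (ℤX.-‿cong (ℤX.+-congʳ {x = f ⊛ h} (ℤ[X]-Properties.⊛-const g N))) ⟩
      g ⊛ const N ⊖ (scale N g ⊕ f ⊛ h)    ≈⟨ ℤX.+-congˡ {x = g ⊛ const N} (ℤX.-‿cong (coeffwise λ i → ≡.sym (x-y≐ i))) ⟩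
      g ⊛ const N ⊖ (x ⊖ y)                ∎

  ≈mod⇒Cong : ∀ {N x y} → x ≈ y mod const N → Cong N f x y
  ≈mod⇒Cong {N} {x} {y} (≈mod (g , ℤX.≈mod (h , hf≈))) = g , neg h , coeff-≡ x-y≈
    where
    open ℤX.≈-Reasoning
    undo : ∀ G D → D ≈ₚ G ⊖ (G ⊖ D)
    undo = Solver.solve-∀ ring
    rearrange : ∀ G f h → G ⊖ h ⊛ f ≈ₚ G ⊕ f ⊛ neg h
    rearrange = Solver.solve-∀ ring
    x-y≈ : x ⊖ y ≈ₚ scale N g ⊕ f ⊛ neg h
    x-y≈ = begin
      x ⊖ y                                   ≈⟨ undo (g ⊛ const N) (x ⊖ y) ⟩
      g ⊛ const N ⊖ (g ⊛ const N ⊖ (x ⊖ y))  ≈⟨ ℤX.+-congˡ {x = g ⊛ const N} (ℤX.-‿cong (ℤX.sym hf≈)) ⟩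
      g ⊛ const N ⊖ h ⊛ f                     ≈⟨ rearrange (g ⊛ const N) f h ⟩
      g ⊛ const N ⊕ f ⊛ neg h                 ≈⟨ ℤX.+-congʳ {x = f ⊛ neg h} (ℤ[X]-Properties.⊛-const g N) ⟩
      scale N g ⊕ f ⊛ neg h                   ∎

  ≈mod⇒+multiple : ∀ {N x y} → x ≈ y mod const N → ∃ λ g → y ⊕ scale N g ≈ x
  ≈mod⇒+multiple {N} {x} {y} (≈mod (g , g⊛N≈x-y)) = g , (begin
    y ⊕ scale N g         ≈⟨ +-congˡ {x = y} (≈ₚ⇒≈ (ℤX.sym (ℤ[X]-Properties.⊛-const g N))) ⟩
    y ⊕ g ⊛ const N       ≈⟨ +-congˡ {x = y} g⊛N≈x-y ⟩
    y ⊕ (x ⊖ y)           ≈⟨ cancel x y ⟩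
    x                     ∎)
    where
    open ≈-Reasoning
    cancel : ∀ x y → y ⊕ (x ⊖ y) ≈ x
    cancel = Solver.solve-∀ ring/f

  open Conjugation (ℤ[X] / f) using (_≈ᴹ_mod_; ≈ᴹ-modulus-resp; conjugate-power-to-diagonal)
  open module M {g} = MatrixProperties ((ℤ[X] / f) / g) using (entrywise)

  MCong⇒≈ᴹ : ∀ {N A B} → MCong N f A B → A ≈ᴹ B mod const N
  MCong⇒≈ᴹ (c₁₁ , c₁₂ , c₂₁ , c₂₂) = entrywise (Cong⇒≈mod c₁₁) (Cong⇒≈mod c₁₂) (Cong⇒≈mod c₂₁) (Cong⇒≈mod c₂₂)

  ≈ᴹ⇒MCong : ∀ {N A B} → A ≈ᴹ B mod const N → MCong N f A B
  ≈ᴹ⇒MCong (entrywise c₁₁ c₁₂ c₂₁ c₂₂) = ≈mod⇒Cong c₁₁ , ≈mod⇒Cong c₁₂ , ≈mod⇒Cong c₂₁ , ≈mod⇒Cong c₂₂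

  ≈ᴹI₂⇒I₂+multiple : ∀ {N A} g → A ≈ᴹ I₂ mod const N → ∃ λ X → I₂ ⊞ mscale N X ≈ᴹ A mod g
  ≈ᴹI₂⇒I₂+multiple g (entrywise c₁₁ c₁₂ c₂₁ c₂₂) =
    let x₁₁ , e₁₁ = ≈mod⇒+multiple c₁₁ ; x₁₂ , e₁₂ = ≈mod⇒+multiple c₁₂
        x₂₁ , e₂₁ = ≈mod⇒+multiple c₂₁ ; x₂₂ , e₂₂ = ≈mod⇒+multiple c₂₂
    in mat x₁₁ x₁₂ x₂₁ x₂₂ , entrywise (≈⇒≈-mod e₁₁) (≈⇒≈-mod e₁₂) (≈⇒≈-mod e₂₁) (≈⇒≈-mod e₂₂)

  -- The gap 1 − 2 between the eigenvalues has inverse −1; (1 − 2) · (−1) computes to 1ₚ.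
  conjugate-to-diag[2,1] : ∀ ℓ m {A} → A ≈ᴹ diag (const (+ 2)) 1ₚ mod const (+ ℓ) →
    ∃₂ λ X Y → (I₂ ⊞ mscale (+ ℓ) X) ⊗ (I₂ ⊞ mscale (+ ℓ) Y) ≈ᴹ I₂ mod const (+ (ℓ ℕ.^ suc m)) ×
      ((I₂ ⊞ mscale (+ ℓ) X) ⊗ A ^ᴹ (ℓ ℕ.^ m)) ⊗ (I₂ ⊞ mscale (+ ℓ) Y)
        ≈ᴹ diag (const (+ (2 ℕ.^ (ℓ ℕ.^ m)))) 1ₚ mod const (+ (ℓ ℕ.^ suc m))
  conjugate-to-diag[2,1] ℓ m {A} A≈diag =
    let Q , P , Q≈I , P≈I , QP≈I , QAP≈diag =
          conjugate-power-to-diagonal {const (+ ℓ)} {t = neg 1ₚ} ℓ m (1ₚ , *-identityˡ (const (+ ℓ))) A≈diag (≈-mod-refl 1ₚ)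
        X , Q′≈Q = ≈ᴹI₂⇒I₂+multiple (π ^ suc m) Q≈I
        Y , P′≈P = ≈ᴹI₂⇒I₂+multiple (π ^ suc m) P≈I
    in X , Y ,
       ≈ᴹ-modulus-resp (const-^ ℓ (suc m)) (≈ᴹ-trans (⊗-cong Q′≈Q P′≈P) QP≈I) ,
       ≈ᴹ-modulus-resp (const-^ ℓ (suc m))
         (≈ᴹ-trans (⊗-cong (⊗-congʳ (A ^ᴹ N) Q′≈Q) P′≈P)
         (≈ᴹ-trans QAP≈diag (entrywise (≈⇒≈-mod (const-^ 2 N)) (≈-mod-refl 0ₚ) (≈-mod-refl 0ₚ) (≈⇒≈-mod (1ₚ^n≈1ₚ N)))))
    where
    π : Poly
    π = const (+ ℓ)
    N : ℕ
    N = ℓ ℕ.^ m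
    open MatrixProperties ((ℤ[X] / f) / π ^ suc m) using (≈ᴹ-trans; ⊗-cong; ⊗-congʳ)

-- Fermat's little theorem for the base 2

module Fermat where

  open import Data.Nat
  open import Data.Nat.Properties
  open import Data.Nat.Combinatorics using (_C_; nCk+nC[k+1]≡[n+1]C[k+1]; nCn≡1; k>n⇒nCk≡0; nCk≡n!/k![n-k]!; k![n∸k]!∣n!)
  open import Data.Nat.Divisibility using (_∣_; divides; ∣⇒≤; ∣1⇒≡1; m∣m*n)
  open import Data.Nat.DivMod using (m/n*n≡m)
  open import Data.Nat.Primality using (Prime; euclidsLemma; prime⇒nonTrivial; prime⇒nonZero)
  open import Data.Sum using (inj₁; inj₂)
  open import Relation.Binary.PropositionalEquality
  open import Relation.Nullary using (¬_; contradiction)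
  open import Data.Nat.Tactic.RingSolver using (solve-∀)

  binomialSum : ℕ → ℕ → ℕ
  binomialSum n zero    = 0
  binomialSum n (suc j) = binomialSum n j + n C j

  binomialSum-pascal : ∀ n j → binomialSum (suc n) (suc j) ≡ binomialSum n j + binomialSum n (suc j)
  binomialSum-pascal n zero    = refl
  binomialSum-pascal n (suc j) = begin
    binomialSum (suc n) (suc j) + suc n C suc j
      ≡⟨ cong₂ _+_ (binomialSum-pascal n j) (sym (nCk+nC[k+1]≡[n+1]C[k+1] n j)) ⟩
    (binomialSum n j + binomialSum n (suc j)) + (n C j + n C suc j)
      ≡⟨ regroup (binomialSum n j) (binomialSum n (suc j)) (n C j) (n C suc j) ⟩
    binomialSum n (suc j) + (binomialSum n j + n C j + n C suc j) ∎
    where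
    open ≡-Reasoning
    regroup : ∀ a b c d → (a + b) + (c + d) ≡ b + (a + c + d)
    regroup = solve-∀

  binomialSum-total : ∀ n → binomialSum n (suc n) ≡ 2 ^ n
  binomialSum-total zero    = refl
  binomialSum-total (suc n) = begin
    binomialSum (suc n) (suc (suc n))
      ≡⟨ binomialSum-pascal n (suc n) ⟩
    binomialSum n (suc n) + (binomialSum n (suc n) + n C suc n)
      ≡⟨ cong (λ c → binomialSum n (suc n) + (binomialSum n (suc n) + c)) (k>n⇒nCk≡0 (n<1+n n)) ⟩
    binomialSum n (suc n) + (binomialSum n (suc n) + 0)
      ≡⟨ cong (λ s → s + (s + 0)) (binomialSum-total n) ⟩
    2 ^ n + (2 ^ n + 0) ∎
    where open ≡-Reasoning

  n∣n! : ∀ {n} → .{{NonZero n}} → n ∣ n !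
  n∣n! {suc n} = m∣m*n (n !)

  module _ {p} (p-prime : Prime p) where

    prime∤! : ∀ {j} → j < p → ¬ p ∣ j !
    prime∤! {zero}  _   p∣1 = <⇒≢ (nonTrivial⇒n>1 p {{prime⇒nonTrivial p-prime}}) (sym (∣1⇒≡1 p∣1))
    prime∤! {suc j} j<p p∣j! with euclidsLemma (suc j) (j !) p-prime p∣j!
    ... | inj₁ p∣1+j = <⇒≱ j<p (∣⇒≤ p∣1+j)
    ... | inj₂ p∣j!′ = prime∤! (<-trans (n<1+n j) j<p) p∣j!′

    prime∣C : ∀ {k} → 0 < k → k < p → p ∣ p C k
    prime∣C {k} 0<k k<p with euclidsLemma (p C k) (k ! * (p ∸ k) !) p-prime p∣C*k!*[p∸k]!
      where
      instance _ = k !* (p ∸ k) !≢0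
      C*k!*[p∸k]!≡p! : (p C k) * (k ! * (p ∸ k) !) ≡ p !
      C*k!*[p∸k]!≡p! = trans (cong (_* (k ! * (p ∸ k) !)) (nCk≡n!/k![n-k]! (<⇒≤ k<p)))
                             (m/n*n≡m (k![n∸k]!∣n! (<⇒≤ k<p)))
      p∣C*k!*[p∸k]! : p ∣ (p C k) * (k ! * (p ∸ k) !)
      p∣C*k!*[p∸k]! = subst (p ∣_) (sym C*k!*[p∸k]!≡p!) (n∣n! {{prime⇒nonZero p-prime}})
    ... | inj₁ p∣C = p∣C
    ... | inj₂ p∣k!*[p∸k]! with euclidsLemma (k !) ((p ∸ k) !) p-prime p∣k!*[p∸k]!
    ...   | inj₁ p∣k!     = contradiction p∣k! (prime∤! k<p)
    ...   | inj₂ p∣[p∸k]! = contradiction p∣[p∸k]! (prime∤! (∸-monoʳ-< 0<k (<⇒≤ k<p)))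

    binomialSum≡1-mod : ∀ {j} → 0 < j → j ≤ p → ∃ λ t → binomialSum p j ≡ 1 + p * t
    binomialSum≡1-mod {suc zero}    _ _     = 0 , cong suc (sym (*-zeroʳ p))
    binomialSum≡1-mod {suc (suc j)} _ 2+j≤p with binomialSum≡1-mod {suc j} z<s (<⇒≤ 2+j≤p)
    ... | t , sum≡1+pt with prime∣C {suc j} z<s 2+j≤p
    ...   | divides c C≡cp = t + c , (begin
      binomialSum p (suc j) + p C suc j ≡⟨ cong₂ _+_ sum≡1+pt C≡cp ⟩
      1 + p * t + c * p                  ≡⟨ regroup p t c ⟩
      1 + p * (t + c)                    ∎)
      where
      open ≡-Reasoning
      regroup : ∀ p t c → 1 + p * t + c * p ≡ 1 + p * (t + c)
      regroup = solve-∀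

    fermat₂ : ∃ λ t → 2 ^ p ≡ 2 + p * t
    fermat₂ with binomialSum≡1-mod (>-nonZero⁻¹ p {{prime⇒nonZero p-prime}}) ≤-refl
    ... | t , sum≡1+pt = t , (begin
      2 ^ p                    ≡⟨ binomialSum-total p ⟨
      binomialSum p p + p C p  ≡⟨ cong₂ _+_ sum≡1+pt (nCn≡1 p) ⟩
      1 + p * t + 1            ≡⟨ +-comm (1 + p * t) 1 ⟩
      2 + p * t                ∎)
      where open ≡-Reasoning

-- Residues modulo ℓ

module Residues where

  open QuotientProperties ℤ[X] using (_≈_mod_; ≈mod; _,_; _^_; ≈-mod-trans; ≈⇒≈-mod; sym; *-identityʳ)
  open Lifting ℤ[X] using (const-^; ^-assocˡ; ^-cong-mod)
  open import Data.Integer using (_+_; _*_; _-_)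
  open import Data.Integer.Tactic.RingSolver using (solve-∀)
  open import Data.Nat.Primality using (Prime)
  import Data.Integer.Divisibility.Signed as Signed
  open import Data.Integer.Divisibility using (_∣_)
  open import Relation.Nullary using (¬_)

  const-≈mod⇒∣ : ∀ {a b c} → const a ≈ const b mod const c → c Signed.∣ a - b
  const-≈mod⇒∣ {a} {b} {c} (≈mod (q , coeffwise q⊛c≐a-b)) = Signed.divides (coeff q 0) (begin
    a - b     ≡⟨ q⊛c≐a-b 0 ⟨
    coeff (q ⊛ const c) 0  ≡⟨ coeff-≡ (ℤ[X]-Properties.⊛-const q c) 0 ⟩
    coeff (scale c q) 0    ≡⟨ ℤ[X]-Properties.coeff-scale c q 0 ⟩
    c * coeff q 0          ≡⟨ ℤ.*-comm c (coeff q 0) ⟩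
    coeff q 0 * c          ∎)
    where open ≡.≡-Reasoning

  ∣⇒const-≈mod : ∀ {a b c} → c Signed.∣ a - b → const a ≈ const b mod const c
  ∣⇒const-≈mod {c = c} (Signed.divides q a-b≡qc) =
    ≈mod (const q , ℤ[X]-Properties.∷-cong (≡.trans (ℤ.+-identityʳ (q * c)) (≡.sym a-b≡qc)) ℤ[X]-Properties.≈ₚ-refl)

  2^p^k≈2 : ∀ {p} → Prime p → ∀ k → const (+ 2) ^ (p ℕ.^ k) ≈ const (+ 2) mod const (+ p)
  2^p^k≈2 p-prime zero = ≈⇒≈-mod (*-identityʳ (const (+ 2)))
  2^p^k≈2 {p} p-prime (suc k) = ≈-mod-trans (≈⇒≈-mod (^-assocˡ (const (+ 2)) p (p ℕ.^ k)))
    (≈-mod-trans (^-cong-mod p (2^p^k≈2 p-prime k)) (≈-mod-trans (≈⇒≈-mod (const-^ 2 p)) fermat))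
    where
    fermat : const (+ (2 ℕ.^ p)) ≈ const (+ 2) mod const (+ p)
    fermat with Fermat.fermat₂ p-prime
    ... | t , 2^p≡2+pt = ∣⇒const-≈mod (Signed.divides (+ t) (begin
      + (2 ℕ.^ p) - + 2      ≡⟨ ≡.cong (λ n → + n - + 2) 2^p≡2+pt ⟩
      + (p ℕ.* t)                          ≡⟨ ℤ.pos-* p t ⟩
      + p * + t                            ≡⟨ ℤ.*-comm (+ p) (+ t) ⟩
      + t * + p                            ∎))
      where open ≡.≡-Reasoning

  2^p^k≡2 : ∀ {p} → Prime p → ∀ k → + p Signed.∣ + (2 ℕ.^ (p ℕ.^ k)) - + 2
  2^p^k≡2 {p} p-prime k = const-≈mod⇒∣ (≈-mod-trans (≈⇒≈-mod (sym (const-^ 2 (p ℕ.^ k)))) (2^p^k≈2 p-prime k))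

  ≡2⇒∤a∧∤a∓1 : ∀ {ℓ} a → 3 ℕ.< ℓ → + ℓ Signed.∣ a - + 2 →
    ¬ (+ ℓ ∣ a) × ¬ (+ ℓ ∣ (a - + 1)) × ¬ (+ ℓ ∣ (a + + 1))
  ≡2⇒∤a∧∤a∓1 {ℓ} a ℓ>3 ℓ∣a-2 = excluded a 1 (difference₂ a) (ℕ.s≤s (ℕ.s≤s ℕ.z≤n)) ,
    excluded (a - + 1) 0 (difference₁ a) (ℕ.s≤s ℕ.z≤n) , excluded (a + + 1) 2 (difference₃ a) ℕ.≤-refl
    where
    difference₁ : ∀ a → (a - + 1) - (a - + 2) ≡ + 1
    difference₁ = solve-∀
    difference₂ : ∀ a → a - (a - + 2) ≡ + 2
    difference₂ = solve-∀
    difference₃ : ∀ a → (a + + 1) - (a - + 2) ≡ + 3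
    difference₃ = solve-∀
    excluded : ∀ x c → x - (a - + 2) ≡ + suc c → suc c ℕ.≤ 3 → ¬ (+ ℓ ∣ x)
    excluded x c x-[a-2]≡c c≤3 ℓ∣x = ℕ.<⇒≱ (ℕ.≤-<-trans c≤3 ℓ>3)
      (ℕ.∣⇒≤ (Signed.∣⇒∣ᵤ (≡.subst (+ ℓ Signed.∣_) x-[a-2]≡c (Signed.∣m∣n⇒∣m-n (Signed.∣ᵤ⇒∣ {i = x} ℓ∣x) ℓ∣a-2))))

^ᴹ-closed : ∀ {N f B} → IsSubgroupGL2 N f B → ∀ {A} → B A → ∀ n → B (A ^ᴹ n)
^ᴹ-closed B-subgroup A∈B zero    = IsSubgroupGL2.hasId B-subgroup
^ᴹ-closed B-subgroup A∈B (suc n) = IsSubgroupGL2.closed B-subgroup A∈B (^ᴹ-closed B-subgroup A∈B n)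

open import Data.Nat using (_>_; _≥_; _^_)
open import Data.Nat.Primality using (Prime)
open import Data.Integer using (_-_; _+_)
open import Data.Integer.Divisibility using (_∣_)
open import Relation.Nullary using (¬_)

lemma3p1 : (ℓ d m : ℕ) → Prime ℓ → ℓ > 3 → d ≥ 1 → m ≥ 1 →
    (f : Poly) → MonicOfDegree d f → IsFieldQuot (+ ℓ) f →
    (B : Mat2 → Set) → IsSubgroupGL2 (+ (ℓ ^ m)) f B →
    (∀ A → B A → ∃ λ a → ∃ λ b → ∃ λ c → ∃ λ e → MCong (+ ℓ) f A (intMat a b c e)) →
    (∀ a b c e → ¬ ((+ ℓ) ∣ (a Data.Integer.* e - b Data.Integer.* c)) →
       ∃ λ A → B A × MCong (+ ℓ) f A (intMat a b c e)) →
    ∃₂ λ X Y → MCong (+ (ℓ ^ m)) f ((I₂ ⊞ mscale (+ ℓ) X) ⊗ (I₂ ⊞ mscale (+ ℓ) Y)) I₂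
      × (∃ λ A → B A × ∃ λ a → ¬ ((+ ℓ) ∣ a) × ¬ ((+ ℓ) ∣ (a - + 1)) × ¬ ((+ ℓ) ∣ (a + + 1))
          × MCong (+ (ℓ ^ m)) f (((I₂ ⊞ mscale (+ ℓ) X) ⊗ A) ⊗ (I₂ ⊞ mscale (+ ℓ) Y))
                  (intMat a (+ 0) (+ 0) (+ 1)))
lemma3p1 ℓ _ (suc m) ℓ-prime ℓ>3 _ _ f _ _ B B-subgroup _ B-covers =
  let A , A∈B , A≈diag = B-covers (+ 2) (+ 0) (+ 0) (+ 1) ℓ∤2
      X , Y , QP≈I , QAP≈diag = conjugate-to-diag[2,1] ℓ m (MCong⇒≈ᴹ A≈diag)
      ℓ∤a , ℓ∤a-1 , ℓ∤a+1 = ≡2⇒∤a∧∤a∓1 (+ (2 ^ (ℓ ^ m))) ℓ>3 (2^p^k≡2 ℓ-prime m)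
  in X , Y , ≈ᴹ⇒MCong QP≈I , A ^ᴹ (ℓ ^ m) , ^ᴹ-closed B-subgroup A∈B (ℓ ^ m) ,
     + (2 ^ (ℓ ^ m)) , ℓ∤a , ℓ∤a-1 , ℓ∤a+1 , ≈ᴹ⇒MCong QAP≈diag
  where
  open CongProperties f
  open Residues using (≡2⇒∤a∧∤a∓1; 2^p^k≡2)
  ℓ∤2 : ¬ (+ ℓ ∣ + 2)
  ℓ∤2 ℓ∣2 = ℕ.<⇒≱ (ℕ.<-trans (ℕ.s≤s (ℕ.s≤s (ℕ.s≤s ℕ.z≤n))) ℓ>3) (ℕ.∣⇒≤ ℓ∣2)
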